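{- Let $\mathcal{G}$ be a finite, simple, connected undirected graph with vertex set $V$, and let $G$ and $G'$ be facet graphs of $\mathcal{G}$ such that an edge $xy$ of $\mathcal{G}$ is present in $G$ oriented from $x$ to $y$ and is not present in $G'$. Then there is a partition $V=V_0\sqcup V_1$ with $x\in V_0$, $y\in V_1$, such that every edge of $\mathcal{G}$ between $V_0$ and $V_1$ is either not present in $G$ or oriented in $G$ from $V_0$ to $V_1$, and is either not present in $G'$ or oriented in $G'$ from $V_1$ to $V_0$.
   Context: A layering is $l:V\to\mathbb{Z}$ with $|l(u)-l(v)|\le1$ for every edge $uv$ of $\mathcal{G}$ such that the edges $E_l=\{uv:|l(u)-l(v)|=1\}$ form a connected spanning subgraph of $\mathcal{G}$. Its facet graph is the digraph $(V,E_l)$ where $uv$ is oriented from $u$ to $v$ when $l(v)-l(u)=1$. An edge of $\mathcal{G}$ is present in a facet graph if it belongs to its edge set $E_l$. -}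

module Defs where

open import Data.Nat using (ℕ; suc)
open import Data.Fin using (Fin)
open import Data.Integer using (ℤ; _-_; ∣_∣; _≤_; +_; 1ℤ; _+_)
open import Data.Product using (_×_)
open import Data.Empty using (⊥)
open import Relation.Nullary using (¬_)
open import Relation.Binary.PropositionalEquality using (_≡_)

record SimpleGraph (n : ℕ) : Set₁ where
  field
    Adj    : Fin n → Fin n → Set
    sym    : ∀ {u v} → Adj u v → Adj v u
    irrefl : ∀ {u} → ¬ Adj u u

data Walk {n : ℕ} (E : Fin n → Fin n → Set) : Fin n → Fin n → Set where
  nil  : ∀ {u} → Walk E u u
  cons : ∀ {u v w} → E u v → Walk E v w → Walk E u w

Connected : {n : ℕ} → (Fin n → Fin n → Set) → Set
Connected {n} E = (u v : Fin n) → Walk E u v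

module _ {n : ℕ} (𝒢 : SimpleGraph n) where
  open SimpleGraph 𝒢

  InEl : (Fin n → ℤ) → Fin n → Fin n → Set
  InEl l u v = Adj u v × (∣ l u - l v ∣ ≡ 1)

  record IsLayering (l : Fin n → ℤ) : Set where
    field
      lipschitz : ∀ {u v} → Adj u v → ∣ l u - l v ∣ Data.Nat.≤ 1
      spanning  : Connected (InEl l)

  -- In the facet graph of l, the edge uv is present (belongs to E_l).
  Present : (Fin n → ℤ) → Fin n → Fin n → Set
  Present l u v = ∣ l u - l v ∣ ≡ 1

  OrientedFrom : (Fin n → ℤ) → Fin n → Fin n → Set
  OrientedFrom l u v = l v ≡ l u + 1ℤ

{-# OPTIONS --safe #-}
-- With d = l − l′, the edge xy has d x < d y, because l climbs by one along it while l′
-- stays level. Cut V at the threshold d x: V₁ is the set of vertices v with d x < d v.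
-- An edge uv from V₀ to V₁ has d u < d v, i.e. l u − l v < l′ u − l′ v; both sides lie
-- in {−1, 0, 1}, so the left one is not 1 and the right one is not −1, which is exactly
-- the required orientation in G and G′.
module Submission where

open import Defs
open import Data.Nat as ℕ using (ℕ; s≤s)
open import Data.Fin using (Fin)
open import Data.Integer using (ℤ; +_; -[1+_]; _-_; _+_; -_; ∣_∣; 0ℤ; 1ℤ; -1ℤ; _<_; +<+; -<+; -<-)
open import Data.Integer.Properties using (_<?_; ≮⇒≥; ≤-<-trans; +-monoˡ-<; <-irrefl; ∣i∣≡0⇒i≡0)
open import Data.Integer.Tactic.RingSolver using (solve-∀)
open import Data.Bool using (Bool; true; false)
open import Data.Product using (Σ; _×_; _,_; map)
open import Data.Sum using (_⊎_; inj₁; inj₂; map₂)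
open import Relation.Nullary using (¬_; does; yes; no)
open import Relation.Nullary.Decidable using (dec-true; dec-false)
open import Relation.Binary.PropositionalEquality using (_≡_; _≢_; refl; sym; subst₂; cong; module ≡-Reasoning)

open ≡-Reasoning

i-j<k-m⇒i-k<j-m : ∀ i j k m → i - j < k - m → i - k < j - m
i-j<k-m⇒i-k<j-m i j k m lt = subst₂ _<_ (lhs i j k m) (rhs i j k m) (+-monoˡ-< (j - k) lt)
  where
  lhs : ∀ i j k m → (i - j) + (j - k) ≡ i - k
  lhs = solve-∀
  rhs : ∀ i j k m → (k - m) + (j - k) ≡ j - m
  rhs = solve-∀

i-j≡1⇒i≡j+1 : ∀ i j → i - j ≡ 1ℤ → i ≡ j + 1ℤ
i-j≡1⇒i≡j+1 i j eq = begin
  i             ≡⟨ split i j ⟩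
  j + (i - j)   ≡⟨ cong (λ k → j + k) eq ⟩
  j + 1ℤ        ∎
  where
  split : ∀ i j → i ≡ j + (i - j)
  split = solve-∀

i-j≡-1⇒j≡i+1 : ∀ i j → i - j ≡ -1ℤ → j ≡ i + 1ℤ
i-j≡-1⇒j≡i+1 i j eq = i-j≡1⇒i≡j+1 j i (begin
  j - i         ≡⟨ swap i j ⟩
  - (i - j)     ≡⟨ cong -_ eq ⟩
  1ℤ            ∎)
  where
  swap : ∀ i j → j - i ≡ - (i - j)
  swap = solve-∀

i≡j+1⇒i-j≡-1 : ∀ i j → j ≡ i + 1ℤ → i - j ≡ -1ℤ
i≡j+1⇒i-j≡-1 i j refl = drop i
  where
  drop : ∀ i → i - (i + 1ℤ) ≡ -1ℤ
  drop = solve-∀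

∣i∣≤1∧∣i∣≢1⇒i≡0 : ∀ i → ∣ i ∣ ℕ.≤ 1 → ∣ i ∣ ≢ 1 → i ≡ 0ℤ
∣i∣≤1∧∣i∣≢1⇒i≡0 i ∣i∣≤1 ∣i∣≢1 = ∣i∣≡0⇒i≡0 (k≤1∧k≢1⇒k≡0 ∣ i ∣ ∣i∣≤1 ∣i∣≢1)
  where
  k≤1∧k≢1⇒k≡0 : ∀ k → k ℕ.≤ 1 → k ≢ 1 → k ≡ 0
  k≤1∧k≢1⇒k≡0 0 _ _ = refl
  k≤1∧k≢1⇒k≡0 1 _ k≢1 with () ← k≢1 refl
  k≤1∧k≢1⇒k≡0 (ℕ.suc (ℕ.suc _)) (s≤s ()) _

∣i∣,∣j∣≤1∧i<j⇒i≢1∧j≢-1 : ∀ i j → ∣ i ∣ ℕ.≤ 1 → ∣ j ∣ ℕ.≤ 1 → i < j →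
  (∣ i ∣ ≢ 1 ⊎ i ≡ -1ℤ) × (∣ j ∣ ≢ 1 ⊎ j ≡ 1ℤ)
∣i∣,∣j∣≤1∧i<j⇒i≢1∧j≢-1 (+ ℕ.suc (ℕ.suc _)) _ (s≤s ()) _ _
∣i∣,∣j∣≤1∧i<j⇒i≢1∧j≢-1 -[1+ ℕ.suc _ ] _ (s≤s ()) _ _
∣i∣,∣j∣≤1∧i<j⇒i≢1∧j≢-1 _ (+ ℕ.suc (ℕ.suc _)) _ (s≤s ()) _
∣i∣,∣j∣≤1∧i<j⇒i≢1∧j≢-1 _ -[1+ ℕ.suc _ ] _ (s≤s ()) _
∣i∣,∣j∣≤1∧i<j⇒i≢1∧j≢-1 -[1+ 0 ] (+ 0) _ _ _ = inj₂ refl , inj₁ λ ()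
∣i∣,∣j∣≤1∧i<j⇒i≢1∧j≢-1 -[1+ 0 ] (+ 1) _ _ _ = inj₂ refl , inj₂ refl
∣i∣,∣j∣≤1∧i<j⇒i≢1∧j≢-1 (+ 0) (+ 1) _ _ _ = inj₁ (λ ()) , inj₂ refl
∣i∣,∣j∣≤1∧i<j⇒i≢1∧j≢-1 -[1+ 0 ] -[1+ 0 ] _ _ (-<- ())
∣i∣,∣j∣≤1∧i<j⇒i≢1∧j≢-1 (+ 0) (+ 0) _ _ (+<+ ())
∣i∣,∣j∣≤1∧i<j⇒i≢1∧j≢-1 (+ 1) (+ 0) _ _ (+<+ ())
∣i∣,∣j∣≤1∧i<j⇒i≢1∧j≢-1 (+ 1) (+ 1) _ _ (+<+ (s≤s ()))
∣i∣,∣j∣≤1∧i<j⇒i≢1∧j≢-1 (+ _) -[1+ 0 ] _ _ ()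

threshold-cut : {A : Set} (f : A → ℤ) (t : A) → Σ (A → Bool) λ side →
  side t ≡ false × (∀ {v} → f t < f v → side v ≡ true) ×
  (∀ {u v} → side u ≡ false → side v ≡ true → f u < f v)
threshold-cut {A} f t = above , dec-false (f t <? f t) (<-irrefl refl) , dec-true (f t <? _) , crossing
  where
  above : A → Bool
  above v = does (f t <? f v)
  crossing : ∀ {u v} → above u ≡ false → above v ≡ true → f u < f v
  crossing {u} {v} _ _ with f t <? f u | f t <? f v
  crossing () _ | yes _ | _
  crossing _ () | no _ | no _
  crossing _ _ | no t≮u | yes t<v = ≤-<-trans (≮⇒≥ t≮u) t<v

module _ {n : ℕ} (𝒢 : SimpleGraph n) where
  open SimpleGraph 𝒢 using (Adj)

  Lipschitz : (Fin n → ℤ) → Set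
  Lipschitz l = ∀ {u v} → Adj u v → ∣ l u - l v ∣ ℕ.≤ 1

  ¬Present⇒level : ∀ l {u v} → Lipschitz l → Adj u v → ¬ Present 𝒢 l u v → l u - l v ≡ 0ℤ
  ¬Present⇒level l {u} {v} lip uv = ∣i∣≤1∧∣i∣≢1⇒i≡0 (l u - l v) (lip uv)

  climb-increases-difference : ∀ l l′ {x y} → Lipschitz l′ → Adj x y →
    OrientedFrom 𝒢 l x y → ¬ Present 𝒢 l′ x y → l x - l′ x < l y - l′ y
  climb-increases-difference l l′ {x} {y} lip′ xy climb absent′ =
    i-j<k-m⇒i-k<j-m (l x) (l y) (l′ x) (l′ y)
      (subst₂ _<_ (sym (i≡j+1⇒i-j≡-1 (l x) (l y) climb)) (sym (¬Present⇒level l′ lip′ xy absent′)) -<+)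

  crossing-edge-orientation : ∀ l l′ {u v} → Lipschitz l → Lipschitz l′ → Adj u v →
    l u - l′ u < l v - l′ v →
    (¬ Present 𝒢 l u v ⊎ OrientedFrom 𝒢 l u v) × (¬ Present 𝒢 l′ u v ⊎ OrientedFrom 𝒢 l′ v u)
  crossing-edge-orientation l l′ {u} {v} lip lip′ uv lt =
    map (map₂ (i-j≡-1⇒j≡i+1 (l u) (l v))) (map₂ (i-j≡1⇒i≡j+1 (l′ u) (l′ v)))
      (∣i∣,∣j∣≤1∧i<j⇒i≢1∧j≢-1 (l u - l v) (l′ u - l′ v) (lip uv) (lip′ uv)
        (i-j<k-m⇒i-k<j-m (l u) (l′ u) (l v) (l′ v) lt))

lemma3p10 : {n : ℕ} (𝒢 : SimpleGraph n) → Connected (SimpleGraph.Adj 𝒢) →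
    (l l′ : Fin n → ℤ) → IsLayering 𝒢 l → IsLayering 𝒢 l′ →
    (x y : Fin n) → SimpleGraph.Adj 𝒢 x y →
    Present 𝒢 l x y → OrientedFrom 𝒢 l x y → ¬ Present 𝒢 l′ x y →
    Σ (Fin n → Bool) λ side →
      (side x ≡ false) × (side y ≡ true) ×
      ((u v : Fin n) → side u ≡ false → side v ≡ true → SimpleGraph.Adj 𝒢 u v →
        (¬ Present 𝒢 l u v ⊎ OrientedFrom 𝒢 l u v) ×
        (¬ Present 𝒢 l′ u v ⊎ OrientedFrom 𝒢 l′ v u))
lemma3p10 𝒢 _ l l′ L L′ x y xy _ climb absent′
  with side , side-x , above-x⇒side , cut-increases ← threshold-cut (λ v → l v - l′ v) x =
  side , side-x , above-x⇒side (climb-increases-difference 𝒢 l l′ lip′ xy climb absent′) ,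
  λ u v side-u side-v uv → crossing-edge-orientation 𝒢 l l′ lip lip′ uv (cut-increases side-u side-v)
  where
  lip : Lipschitz 𝒢 l
  lip = IsLayering.lipschitz L
  lip′ : Lipschitz 𝒢 l′
  lip′ = IsLayering.lipschitz L′
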